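{- Let $G_0=(V,E_0)$ be a $(k-1)$-edge-connected graph with $k\ge2$, $Q\subseteq V$, $E$ an edge set on $V$ with costs $c$, ${\cal T}$ the family of tight bisets, $\mathbb{C}_0$ a ${\cal T}$-core, $s\in C_0$, and ${\cal F}=\{\mathbb{A}\in{\cal T}:s\in A^*\}$. Let $H$ be the separability graph of ${\cal F},E$, with terminal set $R={\cal C}$ (the set of ${\cal F}$-cores), root $s$, and each node $e\in E$ of $H$ weighted by $c_e$. Then: (A) the set of neighbors in $H$ of every terminal induces a clique in $H$; (B) every non-terminal node of $H$ has at most $2$ terminal neighbors.
   Context: A biset on $V$ is a pair $\mathbb{A}=(A,A^+)$ with $A\subseteq A^+\subseteq V$; $\partial\mathbb{A}=A^+\setminus A$, $A^*=V\setminus A^+$; $\mathbb{A}$ is proper if $A\ne\emptyset\ne A^*$; $\mathbb{A}\subseteq\mathbb{B}$ means $A\subseteq B$ and $A^+\subseteq B^+$. $d_{G_0}(\mathbb{A})$ is the number of edges of $G_0$ with one end in $A$ and the other in $A^*$. Node capacities: $q(v)=k-1$ if $v\in Q$, $q(v)=\infty$ otherwise, $q(S)=\sum_{v\in S}q(v)$. A proper biset $\mathbb{A}$ is tight if $d_{G_0}(\mathbb{A})+q(\partial\mathbb{A})=k-1$; ${\cal T}$ is the family of tight bisets. A core of a family is an inclusion-minimal member. An edge is contained in a node set $A$ if both its endnodes lie in $A$. For $X\subseteq{\cal C}\cup E$ and $Y\subseteq E\cup\{s\}$, a biset $\mathbb{A}$ separates $X$ from $Y$ if $X\cap Y\cap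 E=\emptyset$, every ${\cal F}$-core in $X$ is contained in $\mathbb{A}$, every edge of $E\cap X$ is contained in $A^+$, and every edge of $E\cap Y$ is contained in $V\setminus A$; $X,Y$ are ${\cal F}$-inseparable if no $\mathbb{A}\in{\cal F}$ separates $X$ from $Y$. The separability graph $H$ of ${\cal F},E$ has node set ${\cal C}\cup E\cup\{s\}$ and an edge $xy$ for every $x\in{\cal C}\cup E$, $y\in E\cup\{s\}$ such that $\{x\},\{y\}$ are ${\cal F}$-inseparable. Terminals are the nodes in $R$; all other nodes are non-terminals. -}

module Defs where

open import Data.Nat using (ℕ; zero; suc; _+_; _*_; _∸_)
open import Data.Bool using (Bool; true; false; _∧_; _∨_; if_then_else_)
open import Data.Fin using (Fin)
open import Data.Fin.Subset using (Subset; _∈_; _∉_; _⊆_; ∁; _∩_; Nonempty)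
open import Data.Vec using (lookup)
open import Data.List using (List; []; _∷_; foldr; map; allFin)
open import Data.Product using (_×_; _,_; proj₁; proj₂; Σ)
open import Data.Empty using (⊥)
open import Relation.Nullary using (¬_)
open import Relation.Binary.PropositionalEquality using (_≡_)

-- Nodes are V = Fin n; edges are ordered pairs of nodes (read as
-- undirected edges).  G₀ is a finite list of edges (a multigraph);
-- E is an indexed family Fin m → V × V (parallel edges allowed).

Edge : ℕ → Set
Edge n = Fin n × Fin n

data ℕ∞ : Set where
  fin : ℕ → ℕ∞
  ∞   : ℕ∞

_+∞_ : ℕ∞ → ℕ∞ → ℕ∞
fin a +∞ fin b = fin (a + b)
fin _ +∞ ∞     = ∞
∞     +∞ _     = ∞

record Biset (n : ℕ) : Set where
  constructor biset
  field
    inner  : Subset n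
    outer  : Subset n
    inner⊆outer : inner ⊆ outer
open Biset public

∂ : ∀ {n} → Biset n → Subset n
∂ 𝔸 = outer 𝔸 ∩ ∁ (inner 𝔸)

star : ∀ {n} → Biset n → Subset n
star 𝔸 = ∁ (outer 𝔸)

Proper : ∀ {n} → Biset n → Set
Proper 𝔸 = Nonempty (inner 𝔸) × Nonempty (star 𝔸)

_⊆ᵇ_ : ∀ {n} → Biset n → Biset n → Set
𝔸 ⊆ᵇ 𝔹 = (inner 𝔸 ⊆ inner 𝔹) × (outer 𝔸 ⊆ outer 𝔹)

crosses : ∀ {n} → Subset n → Subset n → Edge n → Bool
crosses S T (u , v) = (lookup S u ∧ lookup T v) ∨ (lookup S v ∧ lookup T u)

dBetween : ∀ {n} → Subset n → Subset n → List (Edge n) → ℕ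
dBetween S T [] = 0
dBetween S T (e ∷ es) = (if crosses S T e then 1 else 0) + dBetween S T es

dBiset : ∀ {n} → List (Edge n) → Biset n → ℕ
dBiset G 𝔸 = dBetween (inner 𝔸) (star 𝔸) G

EdgeConnected : ∀ {n} → ℕ → List (Edge n) → Set
EdgeConnected {n} l G =
  (S : Subset n) → Nonempty S → Nonempty (∁ S) → l Data.Nat.≤ dBetween S (∁ S) G

Loopless : ∀ {n} → Edge n → Set
Loopless (u , v) = ¬ (u ≡ v)

cap : ∀ {n} → ℕ → Subset n → Fin n → ℕ∞
cap k Q v = if lookup Q v then fin (k ∸ 1) else ∞

capSum : ∀ {n} → ℕ → Subset n → Subset n → ℕ∞
capSum {n} k Q S =
  foldr _+∞_ (fin 0) (map (λ v → if lookup S v then cap k Q v else fin 0) (allFin n))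

Tight : ∀ {n} → ℕ → List (Edge n) → Subset n → Biset n → Set
Tight k G₀ Q 𝔸 = Proper 𝔸 × (fin (dBiset G₀ 𝔸) +∞ capSum k Q (∂ 𝔸) ≡ fin (k ∸ 1))

IsCore : ∀ {n} → (Biset n → Set) → Biset n → Set
IsCore 𝓕 𝔸 = 𝓕 𝔸 × (∀ 𝔹 → 𝓕 𝔹 → 𝔹 ⊆ᵇ 𝔸 → 𝔸 ⊆ᵇ 𝔹)

FamF : ∀ {n} → ℕ → List (Edge n) → Subset n → Fin n → Biset n → Set
FamF k G₀ Q s 𝔸 = Tight k G₀ Q 𝔸 × (s ∈ star 𝔸)

data HNode {n : ℕ} (𝓕 : Biset n → Set) (m : ℕ) : Set where
  core : (ℂ : Biset n) → IsCore 𝓕 ℂ → HNode 𝓕 m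
  edge : Fin m → HNode 𝓕 m
  root : HNode 𝓕 m

EdgeIn : ∀ {n} → Edge n → Subset n → Set
EdgeIn (u , v) S = (u ∈ S) × (v ∈ S)

Separates : ∀ {n m} {𝓕 : Biset n → Set} → (Fin m → Edge n) → Biset n →
            (HNode 𝓕 m → Set) → (HNode 𝓕 m → Set) → Set
Separates {n} {m} {𝓕} E 𝔸 X Y =
  (∀ (e : Fin m) → X (edge e) → Y (edge e) → ⊥)
  × (∀ (ℂ : Biset n) (p : IsCore 𝓕 ℂ) → X (core ℂ p) → ℂ ⊆ᵇ 𝔸)
  × (∀ (e : Fin m) → X (edge e) → EdgeIn (E e) (outer 𝔸))
  × (∀ (e : Fin m) → Y (edge e) → EdgeIn (E e) (∁ (inner 𝔸)))

Inseparable : ∀ {n m} (𝓕 : Biset n → Set) → (Fin m → Edge n) →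
              (HNode 𝓕 m → Set) → (HNode 𝓕 m → Set) → Set
Inseparable {n} 𝓕 E X Y = ¬ (Σ (Biset n) λ 𝔸 → 𝓕 𝔸 × Separates E 𝔸 X Y)

LeftSide : ∀ {n m} {𝓕 : Biset n → Set} → HNode 𝓕 m → Set
LeftSide (core _ _) = Data.Unit.⊤ where import Data.Unit
LeftSide (edge _)   = Data.Unit.⊤ where import Data.Unit
LeftSide root       = ⊥

RightSide : ∀ {n m} {𝓕 : Biset n → Set} → HNode 𝓕 m → Set
RightSide (core _ _) = ⊥
RightSide (edge _)   = Data.Unit.⊤ where import Data.Unit
RightSide root       = Data.Unit.⊤ where import Data.Unit

HArc : ∀ {n m} (𝓕 : Biset n → Set) → (Fin m → Edge n) → HNode 𝓕 m → HNode 𝓕 m → Set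
HArc 𝓕 E x y = LeftSide x × RightSide y × Inseparable 𝓕 E (_≡ x) (_≡ y)

HAdj : ∀ {n m} (𝓕 : Biset n → Set) → (Fin m → Edge n) → HNode 𝓕 m → HNode 𝓕 m → Set
HAdj 𝓕 E x y = HArc 𝓕 E x y Data.Sum.⊎ HArc 𝓕 E y x where import Data.Sum

Terminal : ∀ {n m} {𝓕 : Biset n → Set} → HNode 𝓕 m → Set
Terminal (core _ _) = Data.Unit.⊤ where import Data.Unit
Terminal (edge _)   = ⊥
Terminal root       = ⊥

_≈ᵇ_ : ∀ {n} → Biset n → Biset n → Set
𝔸 ≈ᵇ 𝔹 = (𝔸 ⊆ᵇ 𝔹) × (𝔹 ⊆ᵇ 𝔸)

SameNode : ∀ {n m} {𝓕 : Biset n → Set} → HNode 𝓕 m → HNode 𝓕 m → Set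
SameNode (core 𝔸 _) (core 𝔹 _) = 𝔸 ≈ᵇ 𝔹
SameNode (edge e) (edge f) = e ≡ f
SameNode root root = Data.Unit.⊤ where import Data.Unit
SameNode _ _ = ⊥

{-# OPTIONS --safe #-}
-- A biset 𝔸 is the map sending each node to its region A, ∂𝔸 or A*.  The biset
-- operations act pointwise on these maps and g(𝔸) = d(𝔸) + q(∂𝔸) is a sum of edge and
-- node terms, so submodularity and posimodularity of g are local, finitely checkable
-- facts.  Since every boundary node costs at least k − 1 ≥ 1, uncrossing shows that an
-- 𝓕-core ℂ meeting A⁺ for some 𝔸 ∈ 𝓕 lies in 𝔸: if C meets A then ℂ ∩ 𝔸 ∈ 𝓕, if C
-- meets A* then ℂ ∖ 𝔸 ∈ 𝓕, and C ⊆ ∂𝔸 is impossible because the edges leaving A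
-- would all enter C, making g(𝔸 ∪ ℂ) < k − 1.  Hence the neighbours of a terminal ℂ are
-- edges with an end in C, no member of 𝓕 separates two of them, and cores sharing a
-- node coincide, so an edge touches at most two of them.
module Submission where

open import Defs
open import Algebra.Bundles using (CommutativeSemigroup)
open import Data.Bool using (Bool; true; false; _∧_; _∨_; not; if_then_else_)
open import Data.Bool.Properties using (not-involutive)
open import Data.Empty using (⊥; ⊥-elim)
open import Data.Fin using (Fin; _≟_)
open import Data.Fin.Properties using (any?)
open import Data.Fin.Subset using (Subset; _∈_; _⊆_; ∁)
open import Data.Fin.Subset.Properties using (_∈?_; x∉p⇒x∈∁p; x∈∁p⇒x∉p)
open import Data.List using (List; []; _∷_; map; foldr; allFin)
open import Data.List.Membership.Propositional using () renaming (_∈_ to _∈ˡ_)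
open import Data.List.Membership.Propositional.Properties using (∈-allFin)
open import Data.List.Properties using (map-cong)
open import Data.List.Relation.Unary.Any using (here; there)
open import Data.Nat using (ℕ; zero; suc; _+_; _∸_; _≤_; _≤?_; z≤n; s≤s)
open import Data.Nat.ListAction using (sum)
open import Data.Nat.Properties
  using ( ≤-refl; ≤-trans; ≤-antisym; +-mono-≤; m≤n+m; +-assoc; +-comm; +-identityʳ
        ; +-cancelˡ-≤; +-cancelʳ-≤; n≤0⇒n≡0; ∸-monoˡ-≤; +-commutativeSemigroup)
open import Function using (_∘_; case_of_)
open import Data.Product using (_×_; _,_; proj₁; proj₂; ∃)
open import Data.Sum using (_⊎_; inj₁; inj₂; swap)
open import Data.Vec using (lookup; tabulate)
open import Data.Vec.Properties using (lookup-map; lookup-zipWith; lookup∘tabulate; []=⇒lookup; lookup⇒[]=)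
open import Data.Unit using (tt)
open import Data.List.Relation.Unary.All using (All)
open import Relation.Binary.PropositionalEquality
  using (_≡_; _≢_; refl; sym; trans; cong; cong₂; subst; subst₂)
open import Relation.Binary.PropositionalEquality.Algebra using (isMagma)
open import Relation.Nullary using (¬_; Dec; yes; no)
open import Relation.Nullary.Decidable using (⌊_⌋; toWitness; ¬?; _×-dec_; _→-dec_; decidable-stable)
open import Relation.Unary using (Pred; Decidable)

import Algebra.Properties.CommutativeSemigroup as CommSemigroupProperties

infix 4 _≤∞_

data _≤∞_ : ℕ∞ → ℕ∞ → Set where
  fin≤fin : ∀ {a b} → a ≤ b → fin a ≤∞ fin b
  ≤∞-top  : ∀ {x} → x ≤∞ ∞

fin≤fin⁻¹ : ∀ {a b} → fin a ≤∞ fin b → a ≤ b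
fin≤fin⁻¹ (fin≤fin a≤b) = a≤b

≤∞-refl : ∀ {x} → x ≤∞ x
≤∞-refl {fin a} = fin≤fin ≤-refl
≤∞-refl {∞}     = ≤∞-top

≤∞-trans : ∀ {x y z} → x ≤∞ y → y ≤∞ z → x ≤∞ z
≤∞-trans (fin≤fin p) (fin≤fin q) = fin≤fin (≤-trans p q)
≤∞-trans _           ≤∞-top      = ≤∞-top

≤∞-reflexive : ∀ {x y} → x ≡ y → x ≤∞ y
≤∞-reflexive refl = ≤∞-refl

≤∞-≡-trans : ∀ {x y z} → x ≤∞ y → y ≡ z → x ≤∞ z
≤∞-≡-trans x≤y refl = x≤y

+∞-mono : ∀ {x y u w} → x ≤∞ y → u ≤∞ w → x +∞ u ≤∞ y +∞ w
+∞-mono (fin≤fin p) (fin≤fin q) = fin≤fin (+-mono-≤ p q)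
+∞-mono (fin≤fin _) ≤∞-top      = ≤∞-top
+∞-mono ≤∞-top      _           = ≤∞-top

+∞-identityʳ : ∀ x → x +∞ fin 0 ≡ x
+∞-identityʳ (fin a) = cong fin (+-identityʳ a)
+∞-identityʳ ∞       = refl

+∞-comm : ∀ x y → x +∞ y ≡ y +∞ x
+∞-comm (fin a) (fin b) = cong fin (+-comm a b)
+∞-comm (fin _) ∞       = refl
+∞-comm ∞       (fin _) = refl
+∞-comm ∞       ∞       = refl

+∞-assoc : ∀ x y z → (x +∞ y) +∞ z ≡ x +∞ (y +∞ z)
+∞-assoc (fin a) (fin b) (fin c) = cong fin (+-assoc a b c)
+∞-assoc (fin _) (fin _) ∞       = refl
+∞-assoc (fin _) ∞       _       = refl
+∞-assoc ∞       _       _       = refl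

+∞-commutativeSemigroup : CommutativeSemigroup _ _
+∞-commutativeSemigroup = record
  { isCommutativeSemigroup = record
    { isSemigroup = record { isMagma = isMagma _+∞_ ; assoc = +∞-assoc }
    ; comm        = +∞-comm
    }
  }

open CommSemigroupProperties +-commutativeSemigroup using () renaming (interchange to +-interchange)
open CommSemigroupProperties +∞-commutativeSemigroup using () renaming (interchange to +∞-interchange)

x≤∞y+∞x : ∀ x y → x ≤∞ y +∞ x
x≤∞y+∞x (fin a) (fin b) = fin≤fin (m≤n+m a b)
x≤∞y+∞x (fin _) ∞       = ≤∞-top
x≤∞y+∞x ∞       (fin _) = ≤∞-top
x≤∞y+∞x ∞       ∞       = ≤∞-top

x≤∞x+∞y : ∀ x y → x ≤∞ x +∞ y
x≤∞x+∞y x y = subst (x ≤∞_) (+∞-comm y x) (x≤∞y+∞x x y)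

x+∞y≤∞fin⇒x≤∞fin : ∀ {x y a b} → x +∞ y ≤∞ fin (a + b) → fin b ≤∞ y → x ≤∞ fin a
x+∞y≤∞fin⇒x≤∞fin {fin x} {fin y} {a} {b} (fin≤fin x+y≤a+b) (fin≤fin b≤y) =
  fin≤fin (+-cancelʳ-≤ b x a (≤-trans (+-mono-≤ (≤-refl {x}) b≤y) x+y≤a+b))

≤∞-antisym : ∀ {x a} → x ≤∞ fin a → fin a ≤∞ x → x ≡ fin a
≤∞-antisym (fin≤fin x≤a) (fin≤fin a≤x) = cong fin (≤-antisym x≤a a≤x)

z≤∞ : ∀ {x} → fin 0 ≤∞ x
z≤∞ {fin _} = fin≤fin z≤n
z≤∞ {∞}     = ≤∞-top

+∞-identityˡ : ∀ x → fin 0 +∞ x ≡ x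
+∞-identityˡ (fin _) = refl
+∞-identityˡ ∞       = refl

_·_ : ℕ → ℕ∞ → ℕ∞
zero  · c = fin 0
suc m · c = c +∞ (m · c)

·-distribʳ : ∀ m n c → (m + n) · c ≡ (m · c) +∞ (n · c)
·-distribʳ zero    n c = sym (+∞-identityˡ (n · c))
·-distribʳ (suc m) n c = trans (cong (c +∞_) (·-distribʳ m n c)) (sym (+∞-assoc c _ _))

·-mono : ∀ {m n} c → m ≤ n → m · c ≤∞ n · c
·-mono c z≤n       = z≤∞
·-mono c (s≤s m≤n) = +∞-mono ≤∞-refl (·-mono c m≤n)

sum∞ : List ℕ∞ → ℕ∞
sum∞ = foldr _+∞_ (fin 0)

sum-map-+ : ∀ {A : Set} (f h : A → ℕ) xs →
            sum (map (λ x → f x + h x) xs) ≡ sum (map f xs) + sum (map h xs)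
sum-map-+ f h []       = refl
sum-map-+ f h (x ∷ xs) =
  trans (cong (f x + h x +_) (sum-map-+ f h xs)) (+-interchange (f x) (h x) _ _)

sum-map-mono : ∀ {A : Set} {f h : A → ℕ} xs → (∀ x → f x ≤ h x) → sum (map f xs) ≤ sum (map h xs)
sum-map-mono []       f≤h = z≤n
sum-map-mono (x ∷ xs) f≤h = +-mono-≤ (f≤h x) (sum-map-mono xs f≤h)

sum∞-map-+ : ∀ {A : Set} (f h : A → ℕ∞) xs →
             sum∞ (map (λ x → f x +∞ h x) xs) ≡ sum∞ (map f xs) +∞ sum∞ (map h xs)
sum∞-map-+ f h []       = refl
sum∞-map-+ f h (x ∷ xs) =
  trans (cong ((f x +∞ h x) +∞_) (sum∞-map-+ f h xs)) (+∞-interchange (f x) (h x) _ _)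

sum∞-map-mono : ∀ {A : Set} {f h : A → ℕ∞} xs → (∀ x → f x ≤∞ h x) → sum∞ (map f xs) ≤∞ sum∞ (map h xs)
sum∞-map-mono []       f≤h = ≤∞-refl
sum∞-map-mono (x ∷ xs) f≤h = +∞-mono (f≤h x) (sum∞-map-mono xs f≤h)

sum∞-map-≥ : ∀ {A : Set} (f : A → ℕ∞) {x xs} → x ∈ˡ xs → f x ≤∞ sum∞ (map f xs)
sum∞-map-≥ f {xs = y ∷ ys} (here refl) = x≤∞x+∞y (f y) _
sum∞-map-≥ f {xs = y ∷ ys} (there x∈ys) = ≤∞-trans (sum∞-map-≥ f x∈ys) (x≤∞y+∞x _ (f y))

sum∞-map-≥₂ : ∀ {A : Set} (f : A → ℕ∞) {x y xs} → x ∈ˡ xs → y ∈ˡ xs → x ≢ y →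
              f x +∞ f y ≤∞ sum∞ (map f xs)
sum∞-map-≥₂ f (here refl)  (here refl)  x≢y = ⊥-elim (x≢y refl)
sum∞-map-≥₂ f (here refl)  (there y∈zs) x≢y = +∞-mono ≤∞-refl (sum∞-map-≥ f y∈zs)
sum∞-map-≥₂ f {x} {y} (there x∈zs) (here refl) x≢y =
  subst (_≤∞ _) (+∞-comm (f y) (f x)) (+∞-mono ≤∞-refl (sum∞-map-≥ f x∈zs))
sum∞-map-≥₂ f {xs = z ∷ zs} (there x∈zs) (there y∈zs) x≢y =
  ≤∞-trans (sum∞-map-≥₂ f x∈zs y∈zs x≢y) (x≤∞y+∞x _ (f z))

counterexample-or-all : ∀ {n p q} {P : Pred (Fin n) p} {Q : Pred (Fin n) q} → Decidable P → Decidable Q →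
                        (∃ λ v → P v × ¬ Q v) ⊎ (∀ v → P v → Q v)
counterexample-or-all P? Q? with any? (λ v → P? v ×-dec ¬? (Q? v))
... | yes found = inj₁ found
... | no  none  = inj₂ λ v p → decidable-stable (Q? v) λ ¬q → none (v , p , ¬q)

-- The region of a node v relative to a biset 𝔸: v ∈ A, v ∈ ∂𝔸 or v ∈ A*.
data Region : Set where
  interior boundary exterior : Region

_≟ʳ_ : (r s : Region) → Dec (r ≡ s)
interior ≟ʳ interior = yes refl
interior ≟ʳ boundary = no λ ()
interior ≟ʳ exterior = no λ ()
boundary ≟ʳ interior = no λ ()
boundary ≟ʳ boundary = yes refl
boundary ≟ʳ exterior = no λ ()
exterior ≟ʳ interior = no λ ()
exterior ≟ʳ boundary = no λ ()
exterior ≟ʳ exterior = yes refl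

∀ʳ? : ∀ {p} {P : Pred Region p} → Decidable P → Dec (∀ r → P r)
∀ʳ? P? with P? interior | P? boundary | P? exterior
... | yes i | yes b | yes e = yes λ { interior → i ; boundary → b ; exterior → e }
... | no ¬i | _     | _     = no λ all → ¬i (all interior)
... | _     | no ¬b | _     = no λ all → ¬b (all boundary)
... | _     | _     | no ¬e = no λ all → ¬e (all exterior)

isInterior isBoundary isExterior : Region → Bool
isInterior r = ⌊ r ≟ʳ interior ⌋
isBoundary r = ⌊ r ≟ʳ boundary ⌋
isExterior r = ⌊ r ≟ʳ exterior ⌋

complementʳ : Region → Region
complementʳ interior = exterior
complementʳ boundary = boundary
complementʳ exterior = interior

-- The region in 𝔸 ∩ 𝔹 = (A ∩ B, A⁺ ∩ B⁺), 𝔸 ∪ 𝔹 = (A ∪ B, A⁺ ∪ B⁺) and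
-- 𝔸 ∖ 𝔹 = (A ∖ B⁺, A⁺ ∖ B) of a node lying in region r of 𝔸 and s of 𝔹.
_∩ʳ_ _∪ʳ_ _∖ʳ_ : Region → Region → Region
interior ∩ʳ s        = s
boundary ∩ʳ exterior = exterior
boundary ∩ʳ _        = boundary
exterior ∩ʳ _        = exterior

interior ∪ʳ _        = interior
boundary ∪ʳ interior = interior
boundary ∪ʳ _        = boundary
exterior ∪ʳ s        = s

r ∖ʳ s = r ∩ʳ complementʳ s

≡interior⇒≢exterior : ∀ {r} → r ≡ interior → r ≢ exterior
≡interior⇒≢exterior refl ()

≡exterior⇒≢interior : ∀ {r} → r ≡ exterior → r ≢ interior
≡exterior⇒≢interior refl ()

-- collapse ∘ region 𝔸 is the region map of (A, A), whose cut is d(A, V ∖ A).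
collapse : Region → Region
collapse interior = interior
collapse _        = exterior

cut : Region → Region → Bool
cut r s = (isInterior r ∧ isExterior s) ∨ (isInterior s ∧ isExterior r)

𝟙 : Bool → ℕ
𝟙 b = if b then 1 else 0

-- The possible regions of a node relative to 𝔸 and ℂ when C = ∂𝔸 and A ⊆ C*.
Layered : Region → Region → Set
Layered a c = (a ≡ boundary → c ≡ interior) × (c ≡ interior → a ≡ boundary) × (a ≡ interior → c ≡ exterior)

-- Each of the following facts is decided by evaluation over all regions.
cut-submodular : ∀ a b a′ b′ →
  𝟙 (cut (a ∩ʳ a′) (b ∩ʳ b′)) + 𝟙 (cut (a ∪ʳ a′) (b ∪ʳ b′)) ≤ 𝟙 (cut a b) + 𝟙 (cut a′ b′)
cut-submodular = toWitness {a? = ∀ʳ? λ _ → ∀ʳ? λ _ → ∀ʳ? λ _ → ∀ʳ? λ _ → _ ≤? _} _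

boundary-submodular : ∀ a a′ →
  𝟙 (isBoundary (a ∩ʳ a′)) + 𝟙 (isBoundary (a ∪ʳ a′)) ≤ 𝟙 (isBoundary a) + 𝟙 (isBoundary a′)
boundary-submodular = toWitness {a? = ∀ʳ? λ _ → ∀ʳ? λ _ → _ ≤? _} _

cut-posimodular : ∀ a b a′ b′ →
  𝟙 (cut (a ∖ʳ a′) (b ∖ʳ b′)) + 𝟙 (cut (a′ ∖ʳ a) (b′ ∖ʳ b)) ≤ 𝟙 (cut a b) + 𝟙 (cut a′ b′)
cut-posimodular = toWitness {a? = ∀ʳ? λ _ → ∀ʳ? λ _ → ∀ʳ? λ _ → ∀ʳ? λ _ → _ ≤? _} _

boundary-posimodular : ∀ a a′ →
  𝟙 (isBoundary (a ∖ʳ a′)) + 𝟙 (isBoundary (a′ ∖ʳ a)) ≤ 𝟙 (isBoundary a) + 𝟙 (isBoundary a′)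
boundary-posimodular = toWitness {a? = ∀ʳ? λ _ → ∀ʳ? λ _ → _ ≤? _} _

layered? : ∀ a c → Dec (Layered a c)
layered? a c =  (a ≟ʳ boundary →-dec c ≟ʳ interior)
          ×-dec (c ≟ʳ interior →-dec a ≟ʳ boundary)
          ×-dec (a ≟ʳ interior →-dec c ≟ʳ exterior)

cut-layered : ∀ a b c e → Layered a c → Layered b e →
  𝟙 (cut (collapse a) (collapse b)) + 𝟙 (cut (a ∪ʳ c) (b ∪ʳ e)) ≤ (𝟙 (cut a b) + 𝟙 (cut a b)) + 𝟙 (cut c e)
cut-layered = toWitness {a? = ∀ʳ? λ a → ∀ʳ? λ b → ∀ʳ? λ c → ∀ʳ? λ e →
                               layered? a c →-dec layered? b e →-dec _ ≤? _} _

boundary-layered : ∀ a c → Layered a c → 𝟙 (isBoundary (a ∪ʳ c)) ≤ 𝟙 (isBoundary c)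
boundary-layered = toWitness {a? = ∀ʳ? λ a → ∀ʳ? λ c → layered? a c →-dec _ ≤? _} _

∩ʳ-interior⁻¹ : ∀ r s → r ∩ʳ s ≡ interior → r ≡ interior × s ≡ interior
∩ʳ-interior⁻¹ = toWitness {a? = ∀ʳ? λ r → ∀ʳ? λ s → _ ≟ʳ _ →-dec (r ≟ʳ _ ×-dec s ≟ʳ _)} _

∩ʳ-exteriorʳ : ∀ r → r ∩ʳ exterior ≡ exterior
∩ʳ-exteriorʳ = toWitness {a? = ∀ʳ? λ _ → _ ≟ʳ _} _

∪ʳ-≢exterior : ∀ r s → r ≢ exterior → r ∪ʳ s ≢ exterior
∪ʳ-≢exterior = toWitness {a? = ∀ʳ? λ r → ∀ʳ? λ s → ¬? (r ≟ʳ _) →-dec ¬? (_ ≟ʳ _)} _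

∖ʳ-interior⁻¹ : ∀ r s → r ∖ʳ s ≡ interior → s ≡ exterior
∖ʳ-interior⁻¹ = toWitness {a? = ∀ʳ? λ r → ∀ʳ? λ s → _ ≟ʳ _ →-dec s ≟ʳ _} _

interior∖ʳ-≢exterior : ∀ s → s ≢ interior → interior ∖ʳ s ≢ exterior
interior∖ʳ-≢exterior = toWitness {a? = ∀ʳ? λ s → ¬? (s ≟ʳ _) →-dec ¬? (_ ≟ʳ _)} _

boundary-by-elimination : ∀ r → r ≢ interior → r ≢ exterior → r ≡ boundary
boundary-by-elimination = toWitness {a? = ∀ʳ? λ r → ¬? (r ≟ʳ _) →-dec ¬? (r ≟ʳ _) →-dec r ≟ʳ _} _

interior-by-elimination : ∀ r → r ≢ exterior → r ≢ boundary → r ≡ interior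
interior-by-elimination = toWitness {a? = ∀ʳ? λ r → ¬? (r ≟ʳ _) →-dec ¬? (r ≟ʳ _) →-dec r ≟ʳ _} _

exterior-by-elimination : ∀ r → r ≢ interior → r ≢ boundary → r ≡ exterior
exterior-by-elimination = toWitness {a? = ∀ʳ? λ r → ¬? (r ≟ʳ _) →-dec ¬? (r ≟ʳ _) →-dec r ≟ʳ _} _

collapse-≢boundary : ∀ r → collapse r ≢ boundary
collapse-≢boundary = toWitness {a? = ∀ʳ? λ r → ¬? (collapse r ≟ʳ _)} _

-- Bisets as region maps

Regions : ℕ → Set
Regions n = Fin n → Region

_∩ᴿ_ _∪ᴿ_ _∖ᴿ_ : ∀ {n} → Regions n → Regions n → Regions n
(ρ ∩ᴿ σ) v = ρ v ∩ʳ σ v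
(ρ ∪ᴿ σ) v = ρ v ∪ʳ σ v
(ρ ∖ᴿ σ) v = ρ v ∖ʳ σ v

classify : Bool → Bool → Region
classify true  _     = interior
classify false true  = boundary
classify false false = exterior

module _ {n : ℕ} where

  region : Biset n → Regions n
  region Z v = classify (lookup (inner Z) v) (lookup (outer Z) v)

  lookup-inner : ∀ Z v → lookup (inner Z) v ≡ isInterior (region Z v)
  lookup-inner Z v with lookup (inner Z) v | lookup (outer Z) v
  ... | true  | _     = refl
  ... | false | true  = refl
  ... | false | false = refl

  lookup-outer : ∀ Z v → lookup (outer Z) v ≡ not (isExterior (region Z v))
  lookup-outer Z v with lookup (inner Z) v in v∈A | lookup (outer Z) v in v∉A⁺
  ... | true  | true  = refl
  ... | true  | false = trans (sym v∉A⁺) ([]=⇒lookup (inner⊆outer Z (lookup⇒[]= v (inner Z) v∈A)))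
  ... | false | true  = refl
  ... | false | false = refl

  lookup-star : ∀ Z v → lookup (star Z) v ≡ isExterior (region Z v)
  lookup-star Z v = trans (lookup-map v not (outer Z))
                          (trans (cong not (lookup-outer Z v)) (not-involutive _))

  lookup-∂ : ∀ Z v → lookup (∂ Z) v ≡ isBoundary (region Z v)
  lookup-∂ Z v = trans (lookup-zipWith _∧_ v (outer Z) (∁ (inner Z)))
                       (trans (cong₂ _∧_ (lookup-outer Z v)
                                         (trans (lookup-map v not (inner Z)) (cong not (lookup-inner Z v))))
                              (boundary-by-cases (region Z v)))
    where
    boundary-by-cases : ∀ r → not (isExterior r) ∧ not (isInterior r) ≡ isBoundary r
    boundary-by-cases interior = refl
    boundary-by-cases boundary = refl
    boundary-by-cases exterior = refl

  ∈inner⇒interior : ∀ Z {v} → v ∈ inner Z → region Z v ≡ interior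
  ∈inner⇒interior Z v∈A rewrite []=⇒lookup v∈A = refl

  interior⇒∈inner : ∀ Z {v} → region Z v ≡ interior → v ∈ inner Z
  interior⇒∈inner Z {v} int = lookup⇒[]= v (inner Z) (trans (lookup-inner Z v) (cong isInterior int))

  exterior⇒∈star : ∀ Z {v} → region Z v ≡ exterior → v ∈ star Z
  exterior⇒∈star Z {v} ext = lookup⇒[]= v (star Z) (trans (lookup-star Z v) (cong isExterior ext))

  ∈star⇒exterior : ∀ Z {v} → v ∈ star Z → region Z v ≡ exterior
  ∈star⇒exterior Z {v} v∈A* = isExterior⁻¹ (trans (sym (lookup-star Z v)) ([]=⇒lookup v∈A*))
    where
    isExterior⁻¹ : ∀ {r} → isExterior r ≡ true → r ≡ exterior
    isExterior⁻¹ {exterior} _ = refl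

  ∈outer⇒≢exterior : ∀ Z {v} → v ∈ outer Z → region Z v ≢ exterior
  ∈outer⇒≢exterior Z {v} v∈A⁺ ext
    with trans (sym ([]=⇒lookup v∈A⁺)) (trans (lookup-outer Z v) (cong (not ∘ isExterior) ext))
  ... | ()

  ≢exterior⇒∈outer : ∀ Z {v} → region Z v ≢ exterior → v ∈ outer Z
  ≢exterior⇒∈outer Z {v} ¬ext =
    lookup⇒[]= v (outer Z) (trans (lookup-outer Z v) (not-exterior (region Z v) ¬ext))
    where
    not-exterior : ∀ r → r ≢ exterior → not (isExterior r) ≡ true
    not-exterior interior _    = refl
    not-exterior boundary _    = refl
    not-exterior exterior ¬ext = ⊥-elim (¬ext refl)

  ⊆ᵇ-by-regions : ∀ {Y Z} → (∀ v → region Y v ≡ interior → region Z v ≡ interior) →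
                  (∀ v → region Z v ≡ exterior → region Y v ≡ exterior) → Y ⊆ᵇ Z
  ⊆ᵇ-by-regions {Y} {Z} int ext =
      (λ {v} v∈Y → interior⇒∈inner Z (int v (∈inner⇒interior Y v∈Y)))
    , (λ {v} v∈Y⁺ → ≢exterior⇒∈outer Z (∈outer⇒≢exterior Y v∈Y⁺ ∘ ext v))

  ⊆ᵇ-refl : ∀ {Z : Biset n} → Z ⊆ᵇ Z
  ⊆ᵇ-refl = (λ v∈Z → v∈Z) , (λ v∈Z⁺ → v∈Z⁺)

  ⊆ᵇ-trans : ∀ {X Y Z : Biset n} → X ⊆ᵇ Y → Y ⊆ᵇ Z → X ⊆ᵇ Z
  ⊆ᵇ-trans (X⊆Y , X⁺⊆Y⁺) (Y⊆Z , Y⁺⊆Z⁺) = Y⊆Z ∘ X⊆Y , Y⁺⊆Z⁺ ∘ X⁺⊆Y⁺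

  biset-of : Regions n → Biset n
  biset-of ρ = biset (tabulate (isInterior ∘ ρ)) (tabulate (not ∘ isExterior ∘ ρ)) interior⊆outer
    where
    interior⊆outer : tabulate (isInterior ∘ ρ) ⊆ tabulate (not ∘ isExterior ∘ ρ)
    interior⊆outer {v} v∈A = lookup⇒[]= v _
      (trans (lookup∘tabulate _ v)
             (interior-not-exterior (ρ v) (trans (sym (lookup∘tabulate _ v)) ([]=⇒lookup v∈A))))
      where
      interior-not-exterior : ∀ r → isInterior r ≡ true → not (isExterior r) ≡ true
      interior-not-exterior interior _ = refl

  region-biset-of : ∀ ρ v → region (biset-of ρ) v ≡ ρ v
  region-biset-of ρ v =
    trans (cong₂ classify (lookup∘tabulate _ v) (lookup∘tabulate _ v)) (classify-regions (ρ v))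
    where
    classify-regions : ∀ r → classify (isInterior r) (not (isExterior r)) ≡ r
    classify-regions interior = refl
    classify-regions boundary = refl
    classify-regions exterior = refl

  infixl 30 _∩ᵇ_ _∖ᵇ_

  _∩ᵇ_ _∖ᵇ_ : Biset n → Biset n → Biset n
  A ∩ᵇ B = biset-of (region A ∩ᴿ region B)
  A ∖ᵇ B = biset-of (region A ∖ᴿ region B)

  biset-of-∩ᴿ-⊆ᵇ : ∀ A σ → biset-of (region A ∩ᴿ σ) ⊆ᵇ A
  biset-of-∩ᴿ-⊆ᵇ A σ = ⊆ᵇ-by-regions {biset-of (region A ∩ᴿ σ)} {A}
    (λ v int → proj₁ (∩ʳ-interior⁻¹ _ _ (trans (sym (region-biset-of _ v)) int)))
    (λ v ext → trans (region-biset-of _ v) (cong (_∩ʳ σ v) ext))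

  ∩ᵇ-⊆ᵇʳ : ∀ A B → A ∩ᵇ B ⊆ᵇ B
  ∩ᵇ-⊆ᵇʳ A B = ⊆ᵇ-by-regions {A ∩ᵇ B} {B}
    (λ v int → proj₂ (∩ʳ-interior⁻¹ _ _ (trans (sym (region-biset-of _ v)) int)))
    (λ v ext → trans (region-biset-of _ v) (trans (cong (region A v ∩ʳ_) ext) (∩ʳ-exteriorʳ (region A v))))

-- The cost g(𝔸) = d(𝔸) + q(∂𝔸)

module Cost {n : ℕ} (k : ℕ) (G : List (Edge n)) (Q : Subset n) where

  crossing : Regions n → Edge n → ℕ
  crossing ρ (u , v) = 𝟙 (cut (ρ u) (ρ v))

  d : Regions n → ℕ
  d ρ = sum (map (crossing ρ) G)

  weight : Regions n → Fin n → ℕ∞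
  weight ρ v = 𝟙 (isBoundary (ρ v)) · cap k Q v

  q : Regions n → ℕ∞
  q ρ = sum∞ (map (weight ρ) (allFin n))

  g : Regions n → ℕ∞
  g ρ = fin (d ρ) +∞ q ρ

  d-cong : ∀ {ρ σ} → (∀ v → ρ v ≡ σ v) → d ρ ≡ d σ
  d-cong ρ≗σ = cong sum (map-cong (λ { (u , v) → cong₂ (λ a b → 𝟙 (cut a b)) (ρ≗σ u) (ρ≗σ v) }) G)

  g-cong : ∀ {ρ σ} → (∀ v → ρ v ≡ σ v) → g ρ ≡ g σ
  g-cong ρ≗σ = cong₂ _+∞_ (cong fin (d-cong ρ≗σ))
                          (cong sum∞ (map-cong (λ v → cong (λ r → 𝟙 (isBoundary r) · cap k Q v) (ρ≗σ v))
                                               (allFin n)))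

  dBetween-regions : ∀ {S T} ρ → (∀ v → lookup S v ≡ isInterior (ρ v)) → (∀ v → lookup T v ≡ isExterior (ρ v)) →
                     dBetween S T G ≡ d ρ
  dBetween-regions {S} {T} ρ S≗ T≗ = go G
    where
    go : ∀ es → dBetween S T es ≡ sum (map (crossing ρ) es)
    go []            = refl
    go ((u , v) ∷ es) =
      cong₂ _+_ (cong 𝟙 (cong₂ _∨_ (cong₂ _∧_ (S≗ u) (T≗ v)) (cong₂ _∧_ (S≗ v) (T≗ u)))) (go es)

  cost-region : ∀ Z → fin (dBiset G Z) +∞ capSum k Q (∂ Z) ≡ g (region Z)
  cost-region Z = cong₂ _+∞_ (cong fin (dBetween-regions (region Z) (lookup-inner Z) (lookup-star Z)))
                             (cong sum∞ (map-cong boundary-weight (allFin n)))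
    where
    if≡𝟙· : ∀ b c → (if b then c else fin 0) ≡ 𝟙 b · c
    if≡𝟙· true  c = sym (+∞-identityʳ c)
    if≡𝟙· false c = refl

    boundary-weight : ∀ v → (if lookup (∂ Z) v then cap k Q v else fin 0) ≡ weight (region Z) v
    boundary-weight v rewrite lookup-∂ Z v = if≡𝟙· (isBoundary (region Z v)) (cap k Q v)

  g-≤₂ : ∀ {ρ₁ ρ₂ σ₁ σ₂} →
         (∀ e → crossing ρ₁ e + crossing ρ₂ e ≤ crossing σ₁ e + crossing σ₂ e) →
         (∀ v → 𝟙 (isBoundary (ρ₁ v)) + 𝟙 (isBoundary (ρ₂ v)) ≤ 𝟙 (isBoundary (σ₁ v)) + 𝟙 (isBoundary (σ₂ v))) →
         g ρ₁ +∞ g ρ₂ ≤∞ g σ₁ +∞ g σ₂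
  g-≤₂ {ρ₁} {ρ₂} {σ₁} {σ₂} edgewise nodewise =
    subst₂ _≤∞_ (sym (+∞-interchange (fin (d ρ₁)) (q ρ₁) (fin (d ρ₂)) (q ρ₂)))
                (sym (+∞-interchange (fin (d σ₁)) (q σ₁) (fin (d σ₂)) (q σ₂)))
                (+∞-mono (fin≤fin d-≤) q-≤)
    where
    d-≤ : d ρ₁ + d ρ₂ ≤ d σ₁ + d σ₂
    d-≤ = subst₂ _≤_ (sum-map-+ (crossing ρ₁) (crossing ρ₂) G) (sum-map-+ (crossing σ₁) (crossing σ₂) G)
                     (sum-map-mono G edgewise)

    weight-≤ : ∀ v → weight ρ₁ v +∞ weight ρ₂ v ≤∞ weight σ₁ v +∞ weight σ₂ v
    weight-≤ v = subst₂ _≤∞_ (·-distribʳ (𝟙 (isBoundary (ρ₁ v))) (𝟙 (isBoundary (ρ₂ v))) (cap k Q v))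
                             (·-distribʳ (𝟙 (isBoundary (σ₁ v))) (𝟙 (isBoundary (σ₂ v))) (cap k Q v))
                             (·-mono (cap k Q v) (nodewise v))

    q-≤ : q ρ₁ +∞ q ρ₂ ≤∞ q σ₁ +∞ q σ₂
    q-≤ = subst₂ _≤∞_ (sum∞-map-+ (weight ρ₁) (weight ρ₂) (allFin n))
                      (sum∞-map-+ (weight σ₁) (weight σ₂) (allFin n))
                      (sum∞-map-mono (allFin n) weight-≤)

  g-submodular : ∀ ρ σ → g (ρ ∩ᴿ σ) +∞ g (ρ ∪ᴿ σ) ≤∞ g ρ +∞ g σ
  g-submodular ρ σ = g-≤₂ {ρ ∩ᴿ σ} {ρ ∪ᴿ σ} {ρ} {σ} (λ { (u , v) → cut-submodular (ρ u) (ρ v) (σ u) (σ v) })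
                          (λ v → boundary-submodular (ρ v) (σ v))

  g-posimodular : ∀ ρ σ → g (ρ ∖ᴿ σ) +∞ g (σ ∖ᴿ ρ) ≤∞ g ρ +∞ g σ
  g-posimodular ρ σ = g-≤₂ {ρ ∖ᴿ σ} {σ ∖ᴿ ρ} {ρ} {σ} (λ { (u , v) → cut-posimodular (ρ u) (ρ v) (σ u) (σ v) })
                           (λ v → boundary-posimodular (ρ v) (σ v))

  g-layered : ∀ {ρ σ} → (∀ v → Layered (ρ v) (σ v)) →
              fin (d (collapse ∘ ρ)) +∞ g (ρ ∪ᴿ σ) ≤∞ fin (d ρ + d ρ) +∞ g σ
  g-layered {ρ} {σ} layered =
    subst₂ _≤∞_ (+∞-assoc (fin (d (collapse ∘ ρ))) (fin (d (ρ ∪ᴿ σ))) (q (ρ ∪ᴿ σ)))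
                (+∞-assoc (fin (d ρ + d ρ)) (fin (d σ)) (q σ))
                (+∞-mono (fin≤fin d-≤) q-≤)
    where
    d-≤ : d (collapse ∘ ρ) + d (ρ ∪ᴿ σ) ≤ (d ρ + d ρ) + d σ
    d-≤ = subst₂ _≤_ (sum-map-+ (crossing (collapse ∘ ρ)) (crossing (ρ ∪ᴿ σ)) G)
                     (trans (sum-map-+ (λ e → crossing ρ e + crossing ρ e) (crossing σ) G)
                            (cong (_+ d σ) (sum-map-+ (crossing ρ) (crossing ρ) G)))
                     (sum-map-mono G λ { (u , v) →
                        cut-layered (ρ u) (ρ v) (σ u) (σ v) (layered u) (layered v) })

    q-≤ : q (ρ ∪ᴿ σ) ≤∞ q σ
    q-≤ = sum∞-map-mono (allFin n) λ v → ·-mono (cap k Q v) (boundary-layered (ρ v) (σ v) (layered v))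

  weight-≥ : ∀ ρ {v} → ρ v ≡ boundary → fin (k ∸ 1) ≤∞ weight ρ v
  weight-≥ ρ {v} bd rewrite bd = subst (fin (k ∸ 1) ≤∞_) (sym (+∞-identityʳ (cap k Q v))) cap-≥
    where
    cap-≥ : fin (k ∸ 1) ≤∞ cap k Q v
    cap-≥ with lookup Q v
    ... | true  = ≤∞-refl
    ... | false = ≤∞-top

  q-≥ : ∀ ρ {v} → ρ v ≡ boundary → fin (k ∸ 1) ≤∞ q ρ
  q-≥ ρ {v} bd = ≤∞-trans (weight-≥ ρ bd) (sum∞-map-≥ (weight ρ) (∈-allFin v))

  q-≥₂ : ∀ ρ {v w} → ρ v ≡ boundary → ρ w ≡ boundary → v ≢ w → fin ((k ∸ 1) + (k ∸ 1)) ≤∞ q ρ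
  q-≥₂ ρ v∈∂ w∈∂ v≢w =
    ≤∞-trans (+∞-mono (weight-≥ ρ v∈∂) (weight-≥ ρ w∈∂)) (sum∞-map-≥₂ (weight ρ) (∈-allFin _) (∈-allFin _) v≢w)

-- Uncrossing tight bisets

module Uncrossing {n : ℕ} (k : ℕ) (G : List (Edge n)) (Q : Subset n)
                  (1≤K : 1 ≤ k ∸ 1) (connected : EdgeConnected (k ∸ 1) G) (s : Fin n) where

  open Cost k G Q

  private
    K : ℕ
    K = k ∸ 1

  F : Biset n → Set
  F = FamF k G Q s

  overfull : ∀ {m} → fin (m + K) ≤∞ fin m → ⊥
  overfull {m} m+K≤m
    with ≤-trans 1≤K (+-cancelˡ-≤ m K 0 (subst (m + K ≤_) (sym (+-identityʳ m)) (fin≤fin⁻¹ m+K≤m)))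
  ... | ()

  d-≥ : ∀ ρ {a b} → (∀ v → ρ v ≢ boundary) → ρ a ≡ interior → ρ b ≡ exterior → K ≤ d ρ
  d-≥ ρ {a} {b} no-boundary a-int b-ext =
    subst (K ≤_) (dBetween-regions ρ S≗ ∁S≗)
          (connected S (a , lookup⇒[]= a S (trans (S≗ a) (cong isInterior a-int)))
                       (b , lookup⇒[]= b (∁ S) (trans (∁S≗ b) (cong isExterior b-ext))))
    where
    S = tabulate (isInterior ∘ ρ)

    S≗ : ∀ v → lookup S v ≡ isInterior (ρ v)
    S≗ = lookup∘tabulate (isInterior ∘ ρ)

    not-interior : ∀ r → r ≢ boundary → not (isInterior r) ≡ isExterior r
    not-interior interior _      = refl
    not-interior boundary ¬bd    = ⊥-elim (¬bd refl)
    not-interior exterior _      = refl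

    ∁S≗ : ∀ v → lookup (∁ S) v ≡ isExterior (ρ v)
    ∁S≗ v = trans (lookup-map v not S) (trans (cong not (S≗ v)) (not-interior (ρ v) (no-boundary v)))

  g-≥ : ∀ ρ {a b} → ρ a ≢ exterior → ρ b ≢ interior → fin K ≤∞ g ρ
  g-≥ ρ {a} {b} a-nonext b-nonint with any? (λ v → ρ v ≟ʳ boundary)
  ... | yes (v , v∈∂) = ≤∞-trans (q-≥ ρ v∈∂) (x≤∞y+∞x (q ρ) (fin (d ρ)))
  ... | no  no-boundary =
    ≤∞-trans (fin≤fin (d-≥ ρ (λ v bd → no-boundary (v , bd)) a-int b-ext)) (x≤∞x+∞y _ (q ρ))
    where
    a-int = interior-by-elimination (ρ a) a-nonext (λ bd → no-boundary (a , bd))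
    b-ext = exterior-by-elimination (ρ b) b-nonint (λ bd → no-boundary (b , bd))

  F⇒g≡K : ∀ A → F A → g (region A) ≡ fin K
  F⇒g≡K A ((_ , tight) , _) = trans (sym (cost-region A)) tight

  F⇒s-exterior : ∀ A → F A → region A s ≡ exterior
  F⇒s-exterior A (_ , s∈A*) = ∈star⇒exterior A s∈A*

  biset-of-∈F : ∀ ρ {a} → ρ a ≡ interior → ρ s ≡ exterior → g ρ ≡ fin K → F (biset-of ρ)
  biset-of-∈F ρ {a} a-int s-ext gρ =
    (((a , interior⇒∈inner (biset-of ρ) (trans (region-biset-of ρ a) a-int)) , (s , s∈Z*))
      , trans (cost-region (biset-of ρ)) (trans (g-cong (region-biset-of ρ)) gρ))
    , s∈Z*
    where
    s∈Z* = exterior⇒∈star (biset-of ρ) (trans (region-biset-of ρ s) s-ext)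

  g-∩ᴿ-≤ : ∀ A B {w} → F A → F B → region A w ≢ exterior → g (region A ∩ᴿ region B) ≤∞ fin K
  g-∩ᴿ-≤ A B FA FB w∈A⁺ =
    x+∞y≤∞fin⇒x≤∞fin (≤∞-≡-trans (g-submodular (region A) (region B)) (cong₂ _+∞_ (F⇒g≡K A FA) (F⇒g≡K B FB)))
                     (g-≥ (region A ∪ᴿ region B) (∪ʳ-≢exterior _ _ w∈A⁺)
                          (≡exterior⇒≢interior (trans (cong (_∪ʳ region B s) (F⇒s-exterior A FA))
                                                      (F⇒s-exterior B FB))))

  F-∩ᵇ : ∀ A B {z} → F A → F B → region A z ≡ interior → region B z ≡ interior → F (A ∩ᵇ B)
  F-∩ᵇ A B FA FB zA zB =
    biset-of-∈F (region A ∩ᴿ region B) z-int s-ext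
      (≤∞-antisym (g-∩ᴿ-≤ A B FA FB (≡interior⇒≢exterior zA))
                  (g-≥ (region A ∩ᴿ region B) (≡interior⇒≢exterior z-int) (≡exterior⇒≢interior s-ext)))
    where
    z-int = cong₂ _∩ʳ_ zA zB
    s-ext = cong (_∩ʳ region B s) (F⇒s-exterior A FA)

  F-∖ᵇ : ∀ C A {z} → F C → F A → (∀ v → region C v ≡ interior → region A v ≢ interior) →
         region C z ≡ interior → region A z ≡ exterior → F (C ∖ᵇ A)
  F-∖ᵇ C A {z} FC FA@((((a , a∈A) , _) , _) , _) disjoint zC zA =
    biset-of-∈F (region C ∖ᴿ region A) z-int s-ext
      (≤∞-antisym (x+∞y≤∞fin⇒x≤∞fin posimodular A∖C-large)
                  (g-≥ (region C ∖ᴿ region A) (≡interior⇒≢exterior z-int) (≡exterior⇒≢interior s-ext)))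
    where
    z-int = cong₂ _∖ʳ_ zC zA
    s-ext = cong (_∖ʳ region A s) (F⇒s-exterior C FC)
    aA = ∈inner⇒interior A a∈A

    posimodular : g (region C ∖ᴿ region A) +∞ g (region A ∖ᴿ region C) ≤∞ fin (K + K)
    posimodular = ≤∞-≡-trans (g-posimodular (region C) (region A)) (cong₂ _+∞_ (F⇒g≡K C FC) (F⇒g≡K A FA))

    A∖C-large : fin K ≤∞ g (region A ∖ᴿ region C)
    A∖C-large = g-≥ (region A ∖ᴿ region C)
      (subst (λ r → r ∖ʳ region C a ≢ exterior) (sym aA) (interior∖ʳ-≢exterior _ λ aC → disjoint a aC aA))
      (≡exterior⇒≢interior (cong (_∖ʳ region C z) zA))

  core-⊆ᵇ-of-common-interior : ∀ C A {z} → IsCore F C → F A →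
                               region C z ≡ interior → region A z ≡ interior → C ⊆ᵇ A
  core-⊆ᵇ-of-common-interior C A (FC , minimal) FA zC zA =
    ⊆ᵇ-trans {X = C} {C ∩ᵇ A} {A} (minimal (C ∩ᵇ A) (F-∩ᵇ C A FC FA zC zA) (biset-of-∩ᴿ-⊆ᵇ C (region A)))
                                  (∩ᵇ-⊆ᵇʳ C A)

  boundary-unique : ∀ ρ {x w} → g ρ ≤∞ fin K → ρ x ≡ boundary → ρ w ≡ boundary → x ≡ w
  boundary-unique ρ {x} {w} g≤K x∈∂ w∈∂ = decidable-stable (x ≟ w) λ x≢w →
    overfull (≤∞-trans (≤∞-trans (q-≥₂ ρ x∈∂ w∈∂ x≢w) (x≤∞y+∞x (q ρ) (fin (d ρ)))) g≤K)

  tight-boundary⇒d≡0 : ∀ ρ {w} → g ρ ≡ fin K → ρ w ≡ boundary → d ρ ≡ 0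
  tight-boundary⇒d≡0 ρ gρ w∈∂ =
    n≤0⇒n≡0 (+-cancelʳ-≤ K (d ρ) 0 (fin≤fin⁻¹ (≤∞-≡-trans (+∞-mono (≤∞-refl {fin (d ρ)}) (q-≥ ρ w∈∂)) gρ)))

  -- d(A, V ∖ A) + g(𝔸 ∪ ℂ) ≤ 2 d(𝔸) + g(ℂ), where d(𝔸) = 0 because 𝔸 has a boundary node.
  layered-absurd : ∀ C A {w} → F C → F A → region A w ≡ boundary → (∀ v → Layered (region A v) (region C v)) → ⊥
  layered-absurd C A {w} FC FA@((((a , a∈A) , _) , _) , _) w∈∂A layered =
    overfull {K} (≤∞-≡-trans (≤∞-trans two-cuts (g-layered layered)) rhs≡K)
    where
    two-cuts : fin (K + K) ≤∞ fin (d (collapse ∘ region A)) +∞ g (region A ∪ᴿ region C)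
    two-cuts =
      +∞-mono (fin≤fin (d-≥ (collapse ∘ region A) (collapse-≢boundary ∘ region A)
                            (cong collapse (∈inner⇒interior A a∈A)) (cong collapse (F⇒s-exterior A FA))))
              (g-≥ (region A ∪ᴿ region C)
                   (≡interior⇒≢exterior (cong₂ _∪ʳ_ w∈∂A (proj₁ (layered w) w∈∂A)))
                   (≡exterior⇒≢interior (cong₂ _∪ʳ_ (F⇒s-exterior A FA) (F⇒s-exterior C FC))))

    rhs≡K : fin (d (region A) + d (region A)) +∞ g (region C) ≡ fin K
    rhs≡K = cong₂ (λ x y → fin (x + x) +∞ y) (tight-boundary⇒d≡0 (region A) (F⇒g≡K A FA) w∈∂A) (F⇒g≡K C FC)

  -- ∂𝔸 ⊆ C, else ∂𝔸 has two nodes; A ⊆ C*, else ∂(𝔸 ∩ ℂ) has two nodes.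
  core-in-boundary-absurd : ∀ C A {w} → F C → F A → (∀ v → region C v ≡ interior → region A v ≡ boundary) →
                            region C w ≡ interior → ⊥
  core-in-boundary-absurd C A {w} FC FA C⊆∂A wC
    with counterexample-or-all (λ v → region A v ≟ʳ boundary) (λ v → region C v ≟ʳ interior)
  ... | inj₁ (x , x∈∂A , x∉C) =
    x∉C (subst (λ v → region C v ≡ interior)
               (sym (boundary-unique (region A) (≤∞-reflexive (F⇒g≡K A FA)) x∈∂A w∈∂A)) wC)
    where w∈∂A = C⊆∂A w wC
  ... | inj₂ ∂A⊆C with counterexample-or-all (λ v → region A v ≟ʳ interior) (λ v → region C v ≟ʳ exterior)
  ...   | inj₂ A⊆C* = layered-absurd C A FC FA (C⊆∂A w wC) (λ v → ∂A⊆C v , C⊆∂A v , A⊆C* v)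
  ...   | inj₁ (y , yA , y∉C*) = case trans (sym yA) (trans (cong (region A) y≡w) w∈∂A) of λ ()
    where
    w∈∂A = C⊆∂A w wC

    y∈∂ : region A y ∩ʳ region C y ≡ boundary
    y∈∂ = trans (cong (_∩ʳ region C y) yA)
                (boundary-by-elimination (region C y) (λ yC → case trans (sym yA) (C⊆∂A y yC) of λ ()) y∉C*)

    y≡w : y ≡ w
    y≡w = boundary-unique (region A ∩ᴿ region C) (g-∩ᴿ-≤ A C FA FC λ ext → case trans (sym w∈∂A) ext of λ ())
                          y∈∂ (cong₂ _∩ʳ_ w∈∂A wC)

  core-disjoint⇒exterior : ∀ C A {w} → IsCore F C → F A →
                           (∀ v → region C v ≡ interior → region A v ≢ interior) →
                           region C w ≡ interior → region A w ≡ exterior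
  core-disjoint⇒exterior C A {w} (FC , minimal) FA disjoint wC
    with any? (λ z → region C z ≟ʳ interior ×-dec region A z ≟ʳ exterior)
  ... | yes (z , zC , zA) =
    ∖ʳ-interior⁻¹ (region C w) (region A w)
      (trans (sym (region-biset-of (region C ∖ᴿ region A) w))
             (∈inner⇒interior (C ∖ᵇ A) (proj₁ C⊆C∖A (interior⇒∈inner C wC))))
    where
    -- ℂ ∖ 𝔸 ∈ 𝓕 lies in the core ℂ, so it contains ℂ; but w ∉ C ∖ A⁺ unless w ∈ A*.
    C⊆C∖A = minimal (C ∖ᵇ A) (F-∖ᵇ C A FC FA disjoint zC zA) (biset-of-∩ᴿ-⊆ᵇ C (complementʳ ∘ region A))
  ... | no C⊆A⁺ = ⊥-elim (core-in-boundary-absurd C A FC FA C⊆∂A wC)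
    where
    C⊆∂A : ∀ v → region C v ≡ interior → region A v ≡ boundary
    C⊆∂A v vC = boundary-by-elimination (region A v) (disjoint v vC) (λ vA → C⊆A⁺ (v , vC , vA))

  core-meeting-outer-⊆ᵇ : ∀ C A {w} → IsCore F C → F A → w ∈ inner C → w ∈ outer A → C ⊆ᵇ A
  core-meeting-outer-⊆ᵇ C A cC FA w∈C w∈A⁺
    with any? (λ z → region C z ≟ʳ interior ×-dec region A z ≟ʳ interior)
  ... | yes (z , zC , zA) = core-⊆ᵇ-of-common-interior C A cC FA zC zA
  ... | no disjoint =
    ⊥-elim (∈outer⇒≢exterior A w∈A⁺ (core-disjoint⇒exterior C A cC FA (λ v vC vA → disjoint (v , vC , vA))
                                                               (∈inner⇒interior C w∈C)))

-- The separability graph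

module SeparabilityGraph {n m : ℕ} {F : Biset n → Set} (E : Fin m → Edge n)
  (core-meeting-outer-⊆ᵇ : ∀ C A {w} → IsCore F C → F A → w ∈ inner C → w ∈ outer A → C ⊆ᵇ A) where

  Touches : Edge n → Subset n → Set
  Touches (u , v) S = u ∈ S ⊎ v ∈ S

  touch-point : ∀ {S T} e → Touches e S → EdgeIn e T → ∃ λ w → w ∈ S × w ∈ T
  touch-point (u , _) (inj₁ u∈S) (u∈T , _) = u , u∈S , u∈T
  touch-point (_ , v) (inj₂ v∈S) (_ , v∈T) = v , v∈S , v∈T

  core-root-separable : ∀ C (p : IsCore F C) → ¬ Inseparable F E (_≡ core C p) (_≡ root)
  core-root-separable C (FC , _) insep =
    insep (C , FC , (λ _ ()) , (λ { _ _ refl → ⊆ᵇ-refl {Z = C} }) , (λ _ ()) , (λ _ ()))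

  core-edge-inseparable⇒touches : ∀ C (p : IsCore F C) e →
                                   Inseparable F E (_≡ core C p) (_≡ edge e) → Touches (E e) (inner C)
  core-edge-inseparable⇒touches C p@(FC , _) e insep with proj₁ (E e) ∈? inner C | proj₂ (E e) ∈? inner C
  ... | yes u∈C | _       = inj₁ u∈C
  ... | no _    | yes v∈C = inj₂ v∈C
  ... | no u∉C  | no v∉C  = ⊥-elim (insep (C , FC , (λ _ ()) , (λ { _ _ refl → ⊆ᵇ-refl {Z = C} }) , (λ _ ())
                                          , λ { _ refl → x∉p⇒x∈∁p u∉C , x∉p⇒x∈∁p v∉C }))

  core-neighbour : ∀ C (p : IsCore F C) x → HAdj F E (core C p) x →
                   ∃ λ e → x ≡ edge e × Touches (E e) (inner C)
  core-neighbour C p (edge e)   (inj₁ (_ , _ , insep)) = e , refl , core-edge-inseparable⇒touches C p e insep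
  core-neighbour C p root       (inj₁ (_ , _ , insep)) = ⊥-elim (core-root-separable C p insep)
  core-neighbour C p (core _ _) (inj₁ (_ , () , _))
  core-neighbour C p _          (inj₂ (_ , () , _))

  cores-sharing-node : ∀ C₁ C₂ {w} → IsCore F C₁ → IsCore F C₂ → w ∈ inner C₁ → w ∈ inner C₂ → C₁ ≈ᵇ C₂
  cores-sharing-node C₁ C₂ p₁ p₂ w∈C₁ w∈C₂ =
      core-meeting-outer-⊆ᵇ C₁ C₂ p₁ (proj₁ p₂) w∈C₁ (inner⊆outer C₂ w∈C₂)
    , core-meeting-outer-⊆ᵇ C₂ C₁ p₂ (proj₁ p₁) w∈C₂ (inner⊆outer C₁ w∈C₁)

  neighbours-of-terminal-adjacent : ∀ t x y → Terminal t → HAdj F E t x → HAdj F E t y → HAdj F E x y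
  neighbours-of-terminal-adjacent (core C p) x y _ t~x t~y
    with core-neighbour C p x t~x | core-neighbour C p y t~y
  ... | e , refl , e-touches | f , refl , f-touches = inj₁ (tt , tt , inseparable)
    where
    inseparable : Inseparable F E (_≡ edge e) (_≡ edge f)
    inseparable (A , FA , _ , _ , e⊆A⁺ , f⊆V∖A)
      with touch-point (E e) e-touches (e⊆A⁺ e refl) | touch-point (E f) f-touches (f⊆V∖A f refl)
    ... | w , w∈C , w∈A⁺ | w′ , w′∈C , w′∉A =
      x∈∁p⇒x∉p w′∉A (proj₁ (core-meeting-outer-⊆ᵇ C A p FA w∈C w∈A⁺) w′∈C)

  at-most-two-terminal-neighbours : ∀ x t₁ t₂ t₃ → Terminal t₁ → Terminal t₂ → Terminal t₃ →
    HAdj F E x t₁ → HAdj F E x t₂ → HAdj F E x t₃ → SameNode t₁ t₂ ⊎ SameNode t₁ t₃ ⊎ SameNode t₂ t₃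
  at-most-two-terminal-neighbours x (core C₁ p₁) (core C₂ p₂) (core C₃ p₃) _ _ _ x~t₁ x~t₂ x~t₃
    with core-neighbour C₁ p₁ x (swap x~t₁) | core-neighbour C₂ p₂ x (swap x~t₂)
       | core-neighbour C₃ p₃ x (swap x~t₃)
  ... | e , refl , touches₁ | _ , refl , touches₂ | _ , refl , touches₃ = pigeonhole touches₁ touches₂ touches₃
    where
    pigeonhole : Touches (E e) (inner C₁) → Touches (E e) (inner C₂) → Touches (E e) (inner C₃) →
                 C₁ ≈ᵇ C₂ ⊎ C₁ ≈ᵇ C₃ ⊎ C₂ ≈ᵇ C₃
    pigeonhole (inj₁ u∈C₁) (inj₁ u∈C₂) _           = inj₁ (cores-sharing-node C₁ C₂ p₁ p₂ u∈C₁ u∈C₂)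
    pigeonhole (inj₂ v∈C₁) (inj₂ v∈C₂) _           = inj₁ (cores-sharing-node C₁ C₂ p₁ p₂ v∈C₁ v∈C₂)
    pigeonhole (inj₁ u∈C₁) (inj₂ _)    (inj₁ u∈C₃) = inj₂ (inj₁ (cores-sharing-node C₁ C₃ p₁ p₃ u∈C₁ u∈C₃))
    pigeonhole (inj₂ v∈C₁) (inj₁ _)    (inj₂ v∈C₃) = inj₂ (inj₁ (cores-sharing-node C₁ C₃ p₁ p₃ v∈C₁ v∈C₃))
    pigeonhole (inj₁ _)    (inj₂ v∈C₂) (inj₂ v∈C₃) = inj₂ (inj₂ (cores-sharing-node C₂ C₃ p₂ p₃ v∈C₂ v∈C₃))
    pigeonhole (inj₂ _)    (inj₁ u∈C₂) (inj₁ u∈C₃) = inj₂ (inj₂ (cores-sharing-node C₂ C₃ p₂ p₃ u∈C₂ u∈C₃))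

lemma5 : (n k : ℕ) → 2 ≤ k →
    (G₀ : List (Edge n)) → All Loopless G₀ → EdgeConnected (k Data.Nat.∸ 1) G₀ →
    (Q : Subset n) →
    (m : ℕ) → (E : Fin m → Edge n) → (∀ e → Loopless (E e)) →
    (C₀ : Biset n) → IsCore (Tight k G₀ Q) C₀ →
    (s : Fin n) → s ∈ inner C₀ →
    -- (A) the neighbours of every terminal form a clique of H
    ((t x y : HNode (FamF k G₀ Q s) m) → Terminal t →
       HAdj (FamF k G₀ Q s) E t x → HAdj (FamF k G₀ Q s) E t y →
       ¬ SameNode x y → HAdj (FamF k G₀ Q s) E x y)
    ×
    -- (B) every non-terminal has at most 2 terminal neighbours
    ((x t₁ t₂ t₃ : HNode (FamF k G₀ Q s) m) → ¬ Terminal x →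
       Terminal t₁ → Terminal t₂ → Terminal t₃ →
       HAdj (FamF k G₀ Q s) E x t₁ → HAdj (FamF k G₀ Q s) E x t₂ →
       HAdj (FamF k G₀ Q s) E x t₃ →
       SameNode t₁ t₂ ⊎ SameNode t₁ t₃ ⊎ SameNode t₂ t₃)
lemma5 n k 2≤k G₀ _ connected Q m E _ C₀ _ s _ =
    (λ t x y t-terminal t~x t~y _ → neighbours-of-terminal-adjacent t x y t-terminal t~x t~y)
  , (λ x t₁ t₂ t₃ _ → at-most-two-terminal-neighbours x t₁ t₂ t₃)
  where
  open SeparabilityGraph E (Uncrossing.core-meeting-outer-⊆ᵇ k G₀ Q (∸-monoˡ-≤ 1 2≤k) connected s)
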